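{- For every graph $G$, \[ \chi(G^2)\le \chi_g(G)\le a\big(\chi(G^2)\big). \]
   Context: Graphs are finite and simple. A graceful coloring of a graph $G$ is a function $f\colon V(G)\to\mathbb{N}$ with two properties. First, $f$ is a proper vertex coloring. Second, the induced difference edge labelling $h\colon E(G)\to\mathbb{N}$, given by $h(uv)=|f(u)-f(v)|$, is a proper edge coloring, meaning any two edges sharing an endpoint receive different labels. A graceful $k$-coloring is a graceful coloring with range contained in $\{1,2,\dots,k\}$. The graceful chromatic number $\chi_g(G)$ is the least $k$ such that $G$ admits a graceful $k$-coloring. $G^2$ denotes the square of $G$: it has the same vertex set as $G$, with two distinct vertices adjacent when their distance in $G$ is at most 2. $\chi(G^2)$ is the chromatic number of $G^2$, also called the distance-two chromatic number of $G$. For a positive integer $n$, $a(n)$ is the least integer $k$ such that $\{1,2,\dots,k\}$ contains a subset $S$ with $|S|=n$ in which no three distinct elements $i,j,l\in S$ satisfy $|i-j|=|j-l|$. This is OEIS sequence A065825. -}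

module Defs where

open import Data.Nat using (ℕ; _≤_; ∣_-_∣)
open import Data.Fin using (Fin)
open import Data.Product using (Σ; _×_; _,_; ∃-syntax)
open import Data.Sum using (_⊎_; inj₁; inj₂)
open import Data.List using (List; length)
open import Data.List.Membership.Propositional using (_∈_)
open import Data.List.Relation.Unary.All using (All)
open import Data.List.Relation.Unary.Unique.Propositional using (Unique)
open import Relation.Binary.PropositionalEquality using (_≡_; _≢_; refl)
open import Relation.Nullary using (¬_)

record Graph : Set₁ where
  field
    n      : ℕ
    Adj    : Fin n → Fin n → Set
    sym    : ∀ {u v} → Adj u v → Adj v u
    irrefl : ∀ {v} → ¬ Adj v v
open Graph public

private
  ≢-sym : ∀ {A : Set} {x y : A} → x ≢ y → y ≢ x
  ≢-sym x≢y refl = x≢y refl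

square : Graph → Graph
square G = record
  { n      = n G
  ; Adj    = Adj²
  ; sym    = λ { (u≢v , p) → ≢-sym u≢v , symPath p }
  ; irrefl = λ { (v≢v , _) → v≢v refl }
  }
  where
    Adj² : Fin (n G) → Fin (n G) → Set
    Adj² u v = (u ≢ v) × (Adj G u v ⊎ ∃[ w ] (Adj G u w × Adj G w v))
    symPath : ∀ {u v} → Adj G u v ⊎ ∃[ w ] (Adj G u w × Adj G w v)
                      → Adj G v u ⊎ ∃[ w ] (Adj G v w × Adj G w u)
    symPath (inj₁ e) = inj₁ (sym G e)
    symPath (inj₂ (w , e₁ , e₂)) = inj₂ (w , sym G e₂ , sym G e₁)

Colorable : Graph → ℕ → Set
Colorable G k = Σ (Fin (n G) → Fin k) λ f → ∀ u v → Adj G u v → f u ≢ f v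

IsChromaticNumber : Graph → ℕ → Set
IsChromaticNumber G c = Colorable G c × (∀ k → Colorable G k → c ≤ k)

-- Graceful colouring f : V → ℕ with range in {1,…,k}:
-- proper, and induced edge labels |f u - f v| form a proper edge colouring
-- (two distinct edges uv, vw sharing the endpoint v get different labels).
IsGracefulColoring : (G : Graph) → (Fin (n G) → ℕ) → Set
IsGracefulColoring G f =
    (∀ u v → Adj G u v → f u ≢ f v)
  × (∀ u v w → Adj G u v → Adj G v w → u ≢ w → ∣ f u - f v ∣ ≢ ∣ f v - f w ∣)

GracefulColorable : Graph → ℕ → Set
GracefulColorable G k = Σ (Fin (n G) → ℕ) λ f →
  IsGracefulColoring G f × (∀ v → 1 ≤ f v × f v ≤ k)

IsGracefulChromaticNumber : Graph → ℕ → Set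
IsGracefulChromaticNumber G g =
  GracefulColorable G g × (∀ k → GracefulColorable G k → g ≤ k)

HasGoodSubset : ℕ → ℕ → Set
HasGoodSubset m k = Σ (List ℕ) λ S →
    Unique S
  × length S ≡ m
  × All (λ x → 1 ≤ x × x ≤ k) S
  × (∀ {i j l} → i ∈ S → j ∈ S → l ∈ S → i ≢ j → j ≢ l → i ≢ l →
       ∣ i - j ∣ ≢ ∣ j - l ∣)

IsA065825 : ℕ → ℕ → Set
IsA065825 m a = HasGoodSubset m a × (∀ k → HasGoodSubset m k → a ≤ k)

{-# OPTIONS --safe #-}
-- A graceful colouring f separates the two ends u, w of every path u v w, since otherwise
-- |f u - f v| = |f v - f w|; so f is a proper colouring of G². Conversely, composing a proper
-- colouring of G² with an enumeration of a set S with no three equidistant elements gives a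
-- graceful colouring: adjacent vertices and the ends of a 2-path receive distinct elements of S,
-- and three distinct elements of S are never equidistant.
module Submission where

open import Defs
open import Data.Nat using (ℕ; suc; _≤_; ∣_-_∣)
open import Data.Nat.Properties using (∣-∣-comm)
open import Data.Fin using (Fin; fromℕ<) renaming (zero to fzero; suc to fsuc)
open import Data.Fin.Properties using (fromℕ<-injective)
open import Data.Product using (_×_; _,_)
open import Data.Sum using (inj₁; inj₂)
open import Data.List using (List; _∷_; lookup)
open import Data.List.Membership.Propositional using (_∈_)
open import Data.List.Membership.Propositional.Properties using (∈-lookup)
open import Data.List.Relation.Unary.All as All using ()
open import Data.List.Relation.Unary.AllPairs using (_∷_)
open import Data.List.Relation.Unary.Unique.Propositional using (Unique)
open import Function using (_∘_)
open import Relation.Binary.PropositionalEquality as ≡ using (_≡_; _≢_; refl; cong)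
open import Relation.Nullary using (contradiction)

lookup-injective : ∀ {A : Set} {xs : List A} → Unique xs → ∀ i j → lookup xs i ≡ lookup xs j → i ≡ j
lookup-injective (_ ∷ _)         fzero    fzero    _  = refl
lookup-injective (x∉xs ∷ _)      fzero    (fsuc j) eq = contradiction eq (All.lookup x∉xs (∈-lookup j))
lookup-injective (x∉xs ∷ _)      (fsuc i) fzero    eq = contradiction (≡.sym eq) (All.lookup x∉xs (∈-lookup i))
lookup-injective (_ ∷ xs-unique) (fsuc i) (fsuc j) eq = cong fsuc (lookup-injective xs-unique i j eq)

shiftToFin : ∀ {k} x → 1 ≤ x → x ≤ k → Fin k
shiftToFin (suc x) _ x<k = fromℕ< x<k

shiftToFin-injective : ∀ {k} x y (1≤x : 1 ≤ x) (x≤k : x ≤ k) (1≤y : 1 ≤ y) (y≤k : y ≤ k) →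
                       shiftToFin x 1≤x x≤k ≡ shiftToFin y 1≤y y≤k → x ≡ y
shiftToFin-injective (suc x) (suc y) _ x<k _ y<k eq = cong suc (fromℕ<-injective x y x<k y<k eq)

EquidistanceFree : List ℕ → Set
EquidistanceFree S = ∀ {i j l} → i ∈ S → j ∈ S → l ∈ S → i ≢ j → j ≢ l → i ≢ l → ∣ i - j ∣ ≢ ∣ j - l ∣

Proper : (G : Graph) {A : Set} → (Fin (n G) → A) → Set
Proper G f = ∀ u v → Adj G u v → f u ≢ f v

adj⇒≢ : ∀ G {u v} → Adj G u v → u ≢ v
adj⇒≢ G u~u refl = irrefl G u~u

proper-finer : ∀ (G : Graph) {A B : Set} {f : Fin (n G) → A} {g : Fin (n G) → B} →
               (∀ u v → g u ≡ g v → f u ≡ f v) → Proper G f → Proper G g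
proper-finer _ g≡⇒f≡ f-proper u v u~v = f-proper u v u~v ∘ g≡⇒f≡ u v

graceful⇒square-proper : ∀ G {f} → IsGracefulColoring G f → Proper (square G) f
graceful⇒square-proper _ (f-proper , _)     u v (_ , inj₁ u~v) = f-proper u v u~v
graceful⇒square-proper _ {f} (_ , f-graceful) u v (u≢v , inj₂ (w , u~w , w~v)) fu≡fv =
  f-graceful u w v u~w w~v u≢v (≡.trans (cong (λ x → ∣ x - f w ∣) fu≡fv) (∣-∣-comm (f v) (f w)))

square-proper⇒graceful : ∀ G {S f} → (∀ v → f v ∈ S) → EquidistanceFree S →
                         Proper (square G) f → IsGracefulColoring G f
square-proper⇒graceful G {f = f} f∈S S-free f-proper² = f-proper , f-graceful
  where
    f-proper : Proper G f
    f-proper u v u~v = f-proper² u v (adj⇒≢ G u~v , inj₁ u~v)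

    f-graceful : ∀ u v w → Adj G u v → Adj G v w → u ≢ w → ∣ f u - f v ∣ ≢ ∣ f v - f w ∣
    f-graceful u v w u~v v~w u≢w = S-free (f∈S u) (f∈S v) (f∈S w)
      (f-proper u v u~v) (f-proper v w v~w) (f-proper² u w (u≢w , inj₂ (v , u~v , v~w)))

gracefulColorable⇒squareColorable : ∀ G {k} → GracefulColorable G k → Colorable (square G) k
gracefulColorable⇒squareColorable G {k} (f , f-graceful , f-bounded) =
  colour , proper-finer (square G) colour≡⇒f≡ (graceful⇒square-proper G f-graceful)
  where
    colour : Fin (n G) → Fin k
    colour v = let (1≤fv , fv≤k) = f-bounded v in shiftToFin (f v) 1≤fv fv≤k

    colour≡⇒f≡ : ∀ u v → colour u ≡ colour v → f u ≡ f v
    colour≡⇒f≡ u v = shiftToFin-injective (f u) (f v) _ _ _ _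

squareColorable⇒gracefulColorable : ∀ G {m k} → Colorable (square G) m → HasGoodSubset m k →
                                    GracefulColorable G k
squareColorable⇒gracefulColorable G (φ , φ-proper) (S , S-unique , refl , S-bounded , S-free) =
  f , square-proper⇒graceful G (∈-lookup ∘ φ) S-free f-proper² , All.lookup S-bounded ∘ ∈-lookup ∘ φ
  where
    f : Fin (n G) → ℕ
    f = lookup S ∘ φ

    f-proper² : Proper (square G) f
    f-proper² = proper-finer (square G) (λ u v → lookup-injective S-unique (φ u) (φ v)) φ-proper

mainTheorem1 : (G : Graph) (c g a : ℕ)
    → IsChromaticNumber (square G) c
    → IsGracefulChromaticNumber G g
    → IsA065825 c a
    → c ≤ g × g ≤ a
mainTheorem1 G c g a (square-colourable , c-least) (graceful-colourable , g-least) (good-subset , _) =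
    c-least g (gracefulColorable⇒squareColorable G graceful-colourable)
  , g-least a (squareColorable⇒gracefulColorable G square-colourable good-subset)
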